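{- Let $x,y,z\in\mathcal{H}_+$ and $k\in\{1,2,3\}$. Suppose $x\stackrel{k}{\rightarrow}y$ and $y\stackrel{k}{\rightarrow}z$, and that $x$ and $z$ are crossing. Then $x\stackrel{k}{\rightarrow}z$.
   Context: Let $\mathcal{H}_+=\{x\in\mathbb{R}^3:x_1+x_2+x_3>0\}$. For $v\in\mathcal{H}_+$ let $p_1^{(v)}=(-v_2-v_3,v_2,v_3)$, $p_2^{(v)}=(v_1,-v_1-v_3,v_3)$, $p_3^{(v)}=(v_1,v_2,-v_1-v_2)$, $\triangle(v)=\mathrm{Conv}(p_1^{(v)},p_2^{(v)},p_3^{(v)})$, and $A(v)=\{\sum_i\lambda_ip_i^{(v)}:\sum_i\lambda_i=1,\lambda_i>0\}$. Points $v,w\in\mathcal{H}_+$ are crossing if $A(v)\cap A(w)\ne\emptyset$, $A(v)\setminus A(w)\ne\emptyset$ and $A(w)\setminus A(v)\ne\emptyset$. For $k\in\{1,2,3\}$ and $x,y\in\mathcal{H}_+$, $x\stackrel{k}{\rightarrow}y$ means: $x$ and $y$ are crossing and $p_k^{(y)}\in\triangle(x)$. -}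

module Defs where

open import Level using (Level; _⊔_) renaming (suc to lsuc)
open import Algebra.Bundles using (CommutativeRing)
open import Data.Product using (Σ; ∃; ∃-syntax; _×_; _,_)
open import Data.Sum using (_⊎_)
open import Data.Fin using (Fin; zero; suc)
open import Relation.Nullary using (¬_)
open import Relation.Binary.Structures using (IsStrictTotalOrder)

record OrderedField (c ℓ : Level) : Set (lsuc (c ⊔ ℓ)) where
  field
    commRing : CommutativeRing c ℓ
  open CommutativeRing commRing public
  field
    _<_ : Carrier → Carrier → Set ℓ
    isStrictTotalOrder : IsStrictTotalOrder _≈_ _<_
    +-mono-< : ∀ {a b} c → a < b → (a + c) < (b + c)
    *-pos : ∀ {a b} → 0# < a → 0# < b → 0# < (a * b)
    inverse : ∀ x → ¬ (x ≈ 0#) → ∃[ y ] ((x * y) ≈ 1#)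

  _≤_ : Carrier → Carrier → Set ℓ
  a ≤ b = (a < b) ⊎ (a ≈ b)

module Geometry {c ℓ : Level} (F : OrderedField c ℓ) where
  open OrderedField F using (Carrier; _≈_; _+_; _*_; -_; 0#; 1#; _<_; _≤_)

  record Pt : Set c where
    constructor pt
    field
      x₁ x₂ x₃ : Carrier
  open Pt public

  _≈ᴾ_ : Pt → Pt → Set ℓ
  u ≈ᴾ w = (x₁ u ≈ x₁ w) × (x₂ u ≈ x₂ w) × (x₃ u ≈ x₃ w)

  _·_ : Carrier → Pt → Pt
  a · u = pt (a * x₁ u) (a * x₂ u) (a * x₃ u)

  _⊕_ : Pt → Pt → Pt
  u ⊕ w = pt (x₁ u + x₁ w) (x₂ u + x₂ w) (x₃ u + x₃ w)

  InH : Pt → Set ℓ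
  InH v = 0# < ((x₁ v + x₂ v) + x₃ v)

  -- the vertices p₁^(v), p₂^(v), p₃^(v)  (index 1,2,3 ↦ zero, suc zero, suc (suc zero))
  p : Fin 3 → Pt → Pt
  p zero v = pt (- (x₂ v + x₃ v)) (x₂ v) (x₃ v)
  p (suc zero) v = pt (x₁ v) (- (x₁ v + x₃ v)) (x₃ v)
  p (suc (suc zero)) v = pt (x₁ v) (x₂ v) (- (x₁ v + x₂ v))

  comb : Carrier → Carrier → Carrier → Pt → Pt
  comb l₁ l₂ l₃ v =
    ((l₁ · p zero v) ⊕ (l₂ · p (suc zero) v)) ⊕ (l₃ · p (suc (suc zero)) v)

  InTriangle : Pt → Pt → Set (c ⊔ ℓ)
  InTriangle v q = ∃[ l₁ ] ∃[ l₂ ] ∃[ l₃ ]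
    (((l₁ + l₂) + l₃) ≈ 1#) × (0# ≤ l₁) × (0# ≤ l₂) × (0# ≤ l₃)
      × (q ≈ᴾ comb l₁ l₂ l₃ v)

  InA : Pt → Pt → Set (c ⊔ ℓ)
  InA v q = ∃[ l₁ ] ∃[ l₂ ] ∃[ l₃ ]
    (((l₁ + l₂) + l₃) ≈ 1#) × (0# < l₁) × (0# < l₂) × (0# < l₃)
      × (q ≈ᴾ comb l₁ l₂ l₃ v)

  Crossing : Pt → Pt → Set (c ⊔ ℓ)
  Crossing v w =
    (∃[ q ] (InA v q × InA w q))
      × (∃[ q ] (InA v q × ¬ InA w q))
      × (∃[ q ] (InA w q × ¬ InA v q))

  Arrow : Fin 3 → Pt → Pt → Set (c ⊔ ℓ)
  Arrow k x y = Crossing x y × InTriangle x (p k y)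

-- For v with positive coordinate sum Σv, the vertex p_k(v) is v − Σv·e_k, so the affine
-- combination of the vertices with weights λ is v − Σv·λ. Hence △(v) is the set of points q
-- with Σq = 0 and q ≤ v coordinatewise, and A(v) the same with strict inequalities.
-- For i ≠ k the vertex p_k(v) agrees with v at i, so p_k(z)_i ≤ y_i = p_k(y)_i ≤ x_i.
-- At k take q ∈ A(x) ∩ A(z): p_k(z) and q both have coordinate sum 0 and q < z = p_k(z)
-- off k, so p_k(z)_k < q_k < x_k.
module Submission where

open import Defs
open import Level using (Level)
open import Algebra.Bundles using (CommutativeRing)
import Algebra.Solver.Ring
open import Algebra.Solver.Ring.AlmostCommutativeRing
  using (_-Raw-AlmostCommutative⟶_; fromCommutativeRing)
open import Data.Empty using (⊥-elim)
open import Data.Fin using (Fin; zero; suc; _≟_)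
open import Data.Integer as ℤ using (ℤ; +_; -[1+_])
import Data.Integer.Properties as ℤ
import Data.Maybe as Maybe
open import Data.Nat as ℕ using (ℕ; zero; suc)
import Data.Nat.Properties as ℕ
open import Data.Product using (_,_; proj₁; proj₂; ∃-syntax)
open import Data.Sign using (Sign)
open import Data.Sum using (inj₁; inj₂)
open import Relation.Binary.Bundles using (StrictPartialOrder)
import Relation.Binary.Construct.StrictToNonStrict as NonStrict
open import Relation.Binary.Definitions using (tri<; tri≈; tri>)
open import Relation.Binary.PropositionalEquality as ≡ using (_≡_; _≢_; cong; subst)
open import Relation.Binary.Structures using (IsStrictTotalOrder)
open import Relation.Nullary using (yes; no; dec⇒maybe)

-- The ring solver needs a coefficient ring with decidable equality; with the carrier itself as
-- coefficients, normal forms could not cancel 1 + -1. The canonical map ℤ → R supplies one.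
module CommutativeRingSolver {c ℓ : Level} (R : CommutativeRing c ℓ) where
  open CommutativeRing R
  open import Algebra.Properties.Ring ring
    using (-‿distribˡ-*; -‿distribʳ-*; -‿+-comm; -‿involutive; -0#≈0#)
  open import Algebra.Properties.CommutativeSemigroup +-commutativeSemigroup using (interchange)
  open import Algebra.Properties.Semiring.Mult semiring using (_×_; ×-homo-+; ×1-homo-*)
  open import Relation.Binary.Reasoning.Setoid setoid

  fromℕ : ℕ → Carrier
  fromℕ n = n × 1#

  fromℤ : ℤ → Carrier
  fromℤ (+ n) = fromℕ n
  fromℤ -[1+ n ] = - fromℕ (suc n)

  ⊖-homo : ∀ m n → fromℤ (m ℤ.⊖ n) ≈ fromℕ m - fromℕ n
  ⊖-homo m zero = begin
    fromℕ m       ≈⟨ +-identityʳ (fromℕ m) ⟨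
    fromℕ m + 0#  ≈⟨ +-congˡ -0#≈0# ⟨
    fromℕ m - 0#  ∎
  ⊖-homo zero (suc n) = sym (+-identityˡ _)
  ⊖-homo (suc m) (suc n) = begin
    fromℤ (suc m ℤ.⊖ suc n)            ≡⟨ cong fromℤ (ℤ.[1+m]⊖[1+n]≡m⊖n m n) ⟩
    fromℤ (m ℤ.⊖ n)                    ≈⟨ ⊖-homo m n ⟩
    fromℕ m - fromℕ n                  ≈⟨ +-identityˡ _ ⟨
    0# + (fromℕ m - fromℕ n)           ≈⟨ +-congʳ (-‿inverseʳ 1#) ⟨
    (1# - 1#) + (fromℕ m - fromℕ n)    ≈⟨ interchange 1# (fromℕ m) (- 1#) (- fromℕ n) ⟨
    (1# + fromℕ m) + (- 1# - fromℕ n)  ≈⟨ +-congˡ (-‿+-comm 1# (fromℕ n)) ⟩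
    (1# + fromℕ m) - (1# + fromℕ n)    ∎

  +-homo : ∀ i j → fromℤ (i ℤ.+ j) ≈ fromℤ i + fromℤ j
  +-homo (+ m) (+ n) = ×-homo-+ 1# m n
  +-homo (+ m) -[1+ n ] = ⊖-homo m (suc n)
  +-homo -[1+ m ] (+ n) = trans (⊖-homo n (suc m)) (+-comm _ _)
  +-homo -[1+ m ] -[1+ n ] = begin
    - fromℕ (suc (suc (m ℕ.+ n)))      ≡⟨ cong (λ k → - fromℕ k) (ℕ.+-suc (suc m) n) ⟨
    - fromℕ (suc m ℕ.+ suc n)          ≈⟨ -‿cong (×-homo-+ 1# (suc m) (suc n)) ⟩
    - (fromℕ (suc m) + fromℕ (suc n))  ≈⟨ -‿+-comm _ _ ⟨
    - fromℕ (suc m) - fromℕ (suc n)    ∎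

  -‿homo : ∀ i → fromℤ (ℤ.- i) ≈ - fromℤ i
  -‿homo (+ zero) = sym -0#≈0#
  -‿homo (+ suc n) = refl
  -‿homo -[1+ n ] = sym (-‿involutive _)

  +◃-homo : ∀ n → fromℤ (Sign.+ ℤ.◃ n) ≈ fromℕ n
  +◃-homo n = reflexive (cong fromℤ (ℤ.+◃n≡+n n))

  -◃-homo : ∀ n → fromℤ (Sign.- ℤ.◃ n) ≈ - fromℕ n
  -◃-homo n = trans (reflexive (cong fromℤ (ℤ.-◃n≡-n n))) (-‿homo (+ n))

  *-homo : ∀ i j → fromℤ (i ℤ.* j) ≈ fromℤ i * fromℤ j
  *-homo (+ m) (+ n) = trans (+◃-homo (m ℕ.* n)) (×1-homo-* m n)
  *-homo (+ m) -[1+ n ] = begin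
    fromℤ (Sign.- ℤ.◃ (m ℕ.* suc n))  ≈⟨ -◃-homo (m ℕ.* suc n) ⟩
    - fromℕ (m ℕ.* suc n)             ≈⟨ -‿cong (×1-homo-* m (suc n)) ⟩
    - (fromℕ m * fromℕ (suc n))       ≈⟨ -‿distribʳ-* _ _ ⟩
    fromℕ m * - fromℕ (suc n)         ∎
  *-homo -[1+ m ] (+ n) = begin
    fromℤ (Sign.- ℤ.◃ (suc m ℕ.* n))  ≈⟨ -◃-homo (suc m ℕ.* n) ⟩
    - fromℕ (suc m ℕ.* n)             ≈⟨ -‿cong (×1-homo-* (suc m) n) ⟩
    - (fromℕ (suc m) * fromℕ n)       ≈⟨ -‿distribˡ-* _ _ ⟩
    - fromℕ (suc m) * fromℕ n         ∎
  *-homo -[1+ m ] -[1+ n ] = begin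
    fromℤ (Sign.+ ℤ.◃ (suc m ℕ.* suc n))  ≈⟨ +◃-homo (suc m ℕ.* suc n) ⟩
    fromℕ (suc m ℕ.* suc n)               ≈⟨ ×1-homo-* (suc m) (suc n) ⟩
    fromℕ (suc m) * fromℕ (suc n)         ≈⟨ -‿involutive _ ⟨
    - - (fromℕ (suc m) * fromℕ (suc n))   ≈⟨ -‿cong (-‿distribˡ-* _ _) ⟩
    - (- fromℕ (suc m) * fromℕ (suc n))   ≈⟨ -‿distribʳ-* _ _ ⟩
    - fromℕ (suc m) * - fromℕ (suc n)     ∎

  ℤ-morphism : ℤ.+-*-rawRing -Raw-AlmostCommutative⟶ fromCommutativeRing R
  ℤ-morphism = record
    { ⟦_⟧ = fromℤ ; +-homo = +-homo ; *-homo = *-homo ; -‿homo = -‿homo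
    ; 0-homo = refl ; 1-homo = +-identityʳ 1# }

  open Algebra.Solver.Ring ℤ.+-*-rawRing (fromCommutativeRing R) ℤ-morphism
    (λ i j → Maybe.map (λ i≡j → reflexive (cong fromℤ i≡j)) (dec⇒maybe (i ℤ.≟ j)))
    public


module OrderedFieldProperties {c ℓ : Level} (F : OrderedField c ℓ) where
  open OrderedField F
  open IsStrictTotalOrder isStrictTotalOrder
    using (isStrictPartialOrder; <-resp-≈; compare; irrefl; asym)
    renaming (trans to <-trans; isEquivalence to ≈-isEquivalence)
  open CommutativeRingSolver commRing using (solve; _:+_; :-_; _:-_; _:=_)
  open import Algebra.Properties.Ring ring
    using (-‿distribˡ-*; -‿distribʳ-*; -‿involutive; -0#≈0#)

  strictPartialOrder : StrictPartialOrder c ℓ ℓ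
  strictPartialOrder = record { isStrictPartialOrder = isStrictPartialOrder }

  open import Relation.Binary.Reasoning.StrictPartialOrder strictPartialOrder

  ≤-trans : ∀ {a b d} → a ≤ b → b ≤ d → a ≤ d
  ≤-trans = NonStrict.trans _≈_ _<_ ≈-isEquivalence <-resp-≈ <-trans

  +-monoʳ-< : ∀ a {b d} → b < d → (a + b) < (a + d)
  +-monoʳ-< a {b} {d} b<d = begin-strict
    a + b  ≈⟨ +-comm a b ⟩
    b + a  <⟨ +-mono-< a b<d ⟩
    d + a  ≈⟨ +-comm d a ⟩
    a + d  ∎

  +-monoˡ-≤ : ∀ a {b d} → b ≤ d → (b + a) ≤ (d + a)
  +-monoˡ-≤ a (inj₁ b<d) = inj₁ (+-mono-< a b<d)
  +-monoˡ-≤ a (inj₂ b≈d) = inj₂ (+-congʳ b≈d)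

  +-mono-<-< : ∀ {a b d e} → a < b → d < e → (a + d) < (b + e)
  +-mono-<-< {b = b} {d} a<b d<e = <-trans (+-mono-< d a<b) (+-monoʳ-< b d<e)

  +-cancelʳ-< : ∀ a {b d} → (b + a) < (d + a) → b < d
  +-cancelʳ-< a {b} {d} b+a<d+a = begin-strict
    b            ≈⟨ x+y-y≈x b a ⟨
    (b + a) - a  <⟨ +-mono-< (- a) b+a<d+a ⟩
    (d + a) - a  ≈⟨ x+y-y≈x d a ⟩
    d            ∎
    where
    x+y-y≈x : ∀ x y → (x + y) - y ≈ x
    x+y-y≈x = solve 2 (λ x y → (x :+ y) :- y := x) refl

  -‿anti-< : ∀ {a b} → a < b → (- b) < (- a)
  -‿anti-< {a} {b} a<b = +-cancelʳ-< (a + b) (begin-strict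
    - b + (a + b)  ≈⟨ -x+[y+x]≈y b a ⟩
    a              <⟨ a<b ⟩
    b              ≈⟨ -x+[x+y]≈y a b ⟨
    - a + (a + b)  ∎)
    where
    -x+[y+x]≈y : ∀ x y → - x + (y + x) ≈ y
    -x+[y+x]≈y = solve 2 (λ x y → :- x :+ (y :+ x) := y) refl
    -x+[x+y]≈y : ∀ x y → - x + (x + y) ≈ y
    -x+[x+y]≈y = solve 2 (λ x y → :- x :+ (x :+ y) := y) refl

  +-pos⇒< : ∀ {a t b} → a + t ≈ b → 0# < t → a < b
  +-pos⇒< {a} {t} {b} a+t≈b 0<t = begin-strict
    a       ≈⟨ +-identityʳ a ⟨
    a + 0#  <⟨ +-monoʳ-< a 0<t ⟩
    a + t   ≈⟨ a+t≈b ⟩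
    b       ∎

  +-nonneg⇒≤ : ∀ {a t b} → a + t ≈ b → 0# ≤ t → a ≤ b
  +-nonneg⇒≤ a+t≈b (inj₁ 0<t) = inj₁ (+-pos⇒< a+t≈b 0<t)
  +-nonneg⇒≤ {a} a+t≈b (inj₂ 0≈t) = inj₂ (trans (sym (+-identityʳ a)) (trans (+-congˡ 0≈t) a+t≈b))

  ≤⇒0≤- : ∀ {a b} → a ≤ b → 0# ≤ (b - a)
  ≤⇒0≤- {a} {b} a≤b = begin
    0#     ≈⟨ -‿inverseʳ a ⟨
    a - a  ≤⟨ +-monoˡ-≤ (- a) a≤b ⟩
    b - a  ∎

  *-nonneg-pos : ∀ {a b} → 0# ≤ a → 0# < b → 0# ≤ (a * b)
  *-nonneg-pos (inj₁ 0<a) 0<b = inj₁ (*-pos 0<a 0<b)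
  *-nonneg-pos {b = b} (inj₂ 0≈a) _ = inj₂ (trans (sym (zeroˡ b)) (*-congʳ 0≈a))

  inverse-pos : ∀ {s t} → 0# < s → s * t ≈ 1# → 0# < t
  inverse-pos {s} {t} 0<s st≈1 with compare 0# t
  ... | tri< 0<t _ _ = 0<t
  ... | tri≈ _ 0≈t _ = ⊥-elim (irrefl 0≈s 0<s)
    where
    1≈0 : 1# ≈ 0#
    1≈0 = trans (sym st≈1) (trans (*-congˡ (sym 0≈t)) (zeroʳ s))
    0≈s : 0# ≈ s
    0≈s = sym (trans (sym (*-identityʳ s)) (trans (*-congˡ 1≈0) (zeroʳ s)))
  ... | tri> _ _ t<0 = ⊥-elim (asym 0<1 1<0)
    where
    0<-1 : 0# < (- 1#)
    0<-1 = begin-strict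
      0#         <⟨ *-pos 0<s 0<-t ⟩
      s * - t    ≈⟨ -‿distribʳ-* s t ⟨
      - (s * t)  ≈⟨ -‿cong st≈1 ⟩
      - 1#       ∎
      where
      0<-t : 0# < (- t)
      0<-t = begin-strict
        0#    ≈⟨ -0#≈0# ⟨
        - 0#  <⟨ -‿anti-< t<0 ⟩
        - t   ∎
    0<1 : 0# < 1#
    0<1 = begin-strict
      0#             <⟨ *-pos 0<-1 0<-1 ⟩
      - 1# * - 1#    ≈⟨ -‿distribˡ-* 1# (- 1#) ⟨
      - (1# * - 1#)  ≈⟨ -‿cong (*-identityˡ (- 1#)) ⟩
      - - 1#         ≈⟨ -‿involutive 1# ⟩
      1#             ∎
    1<0 : 1# < 0#
    1<0 = begin-strict
      1#      ≈⟨ -‿involutive 1# ⟨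
      - - 1#  <⟨ -‿anti-< 0<-1 ⟩
      - 0#    ≈⟨ -0#≈0# ⟩
      0#      ∎

  <-of-≈-sums : ∀ {a s b r} → (a + s) ≈ (b + r) → s < r → b < a
  <-of-≈-sums {a} {s} {b} {r} a+s≈b+r s<r = +-cancelʳ-< r (begin-strict
    b + r  ≈⟨ a+s≈b+r ⟨
    a + s  <⟨ +-monoʳ-< a s<r ⟩
    a + r  ∎)

module TriangleProperties {c ℓ : Level} (F : OrderedField c ℓ) where
  open OrderedField F hiding (zero)
  open Geometry F
  open OrderedFieldProperties F
  open CommutativeRingSolver commRing using (solve; _:+_; _:*_; :-_; _:-_; _:=_; con)
  open IsStrictTotalOrder isStrictTotalOrder using (irrefl) renaming (trans to <-trans)
  open import Algebra.Properties.CommutativeSemigroup +-commutativeSemigroup using (xy∙z≈y∙xz)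
  open import Relation.Binary.Reasoning.Setoid setoid

  coord : Fin 3 → Pt → Carrier
  coord zero = x₁
  coord (suc zero) = x₂
  coord (suc (suc zero)) = x₃

  tabulateᴾ : (Fin 3 → Carrier) → Pt
  tabulateᴾ f = pt (f zero) (f (suc zero)) (f (suc (suc zero)))

  coord-tabulateᴾ : ∀ f i → coord i (tabulateᴾ f) ≡ f i
  coord-tabulateᴾ f zero = ≡.refl
  coord-tabulateᴾ f (suc zero) = ≡.refl
  coord-tabulateᴾ f (suc (suc zero)) = ≡.refl

  ≈ᴾ⇒coord-≈ : ∀ {u w} → u ≈ᴾ w → ∀ i → coord i u ≈ coord i w
  ≈ᴾ⇒coord-≈ (e₁ , _ , _) zero = e₁
  ≈ᴾ⇒coord-≈ (_ , e₂ , _) (suc zero) = e₂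
  ≈ᴾ⇒coord-≈ (_ , _ , e₃) (suc (suc zero)) = e₃

  coord-≈⇒≈ᴾ : ∀ {u w} → (∀ i → coord i u ≈ coord i w) → u ≈ᴾ w
  coord-≈⇒≈ᴾ e = e zero , e (suc zero) , e (suc (suc zero))

  Σᴾ : Pt → Carrier
  Σᴾ v = (x₁ v + x₂ v) + x₃ v

  Σᴾ-cong : ∀ {u w} → u ≈ᴾ w → Σᴾ u ≈ Σᴾ w
  Σᴾ-cong (e₁ , e₂ , e₃) = +-cong (+-cong e₁ e₂) e₃

  _≤ᴾ_ : Pt → Pt → Set ℓ
  u ≤ᴾ w = ∀ i → coord i u ≤ coord i w

  _<ᴾ_ : Pt → Pt → Set ℓ
  u <ᴾ w = ∀ i → coord i u < coord i w

  comb-coord : ∀ l₁ l₂ l₃ v i →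
    coord i (comb l₁ l₂ l₃ v) + coord i (pt l₁ l₂ l₃) * Σᴾ v ≈ ((l₁ + l₂) + l₃) * coord i v
  comb-coord l₁ l₂ l₃ (pt v₁ v₂ v₃) zero = solve 6
    (λ l₁ l₂ l₃ v₁ v₂ v₃ → ((l₁ :* :- (v₂ :+ v₃) :+ l₂ :* v₁) :+ l₃ :* v₁) :+ l₁ :* ((v₁ :+ v₂) :+ v₃)
                           := ((l₁ :+ l₂) :+ l₃) :* v₁)
    refl l₁ l₂ l₃ v₁ v₂ v₃
  comb-coord l₁ l₂ l₃ (pt v₁ v₂ v₃) (suc zero) = solve 6
    (λ l₁ l₂ l₃ v₁ v₂ v₃ → ((l₁ :* v₂ :+ l₂ :* :- (v₁ :+ v₃)) :+ l₃ :* v₂) :+ l₂ :* ((v₁ :+ v₂) :+ v₃)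
                           := ((l₁ :+ l₂) :+ l₃) :* v₂)
    refl l₁ l₂ l₃ v₁ v₂ v₃
  comb-coord l₁ l₂ l₃ (pt v₁ v₂ v₃) (suc (suc zero)) = solve 6
    (λ l₁ l₂ l₃ v₁ v₂ v₃ → ((l₁ :* v₃ :+ l₂ :* v₃) :+ l₃ :* :- (v₁ :+ v₂)) :+ l₃ :* ((v₁ :+ v₂) :+ v₃)
                           := ((l₁ :+ l₂) :+ l₃) :* v₃)
    refl l₁ l₂ l₃ v₁ v₂ v₃

  Σᴾ-comb : ∀ l₁ l₂ l₃ v → Σᴾ (comb l₁ l₂ l₃ v) ≈ 0#
  Σᴾ-comb l₁ l₂ l₃ (pt v₁ v₂ v₃) = solve 6
    (λ l₁ l₂ l₃ v₁ v₂ v₃ →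
       (((l₁ :* :- (v₂ :+ v₃) :+ l₂ :* v₁) :+ l₃ :* v₁)
        :+ ((l₁ :* v₂ :+ l₂ :* :- (v₁ :+ v₃)) :+ l₃ :* v₂))
        :+ ((l₁ :* v₃ :+ l₂ :* v₃) :+ l₃ :* :- (v₁ :+ v₂))
       := con (+ 0))
    refl l₁ l₂ l₃ v₁ v₂ v₃

  Σᴾ-p : ∀ k v → Σᴾ (p k v) ≈ 0#
  Σᴾ-p zero (pt v₁ v₂ v₃) = solve 3 (λ v₁ v₂ v₃ → (:- (v₂ :+ v₃) :+ v₂) :+ v₃ := con (+ 0)) refl v₁ v₂ v₃
  Σᴾ-p (suc zero) (pt v₁ v₂ v₃) = solve 3 (λ v₁ v₂ v₃ → (v₁ :+ :- (v₁ :+ v₃)) :+ v₃ := con (+ 0)) refl v₁ v₂ v₃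
  Σᴾ-p (suc (suc zero)) (pt v₁ v₂ v₃) = solve 3 (λ v₁ v₂ v₃ → (v₁ :+ v₂) :- (v₁ :+ v₂) := con (+ 0)) refl v₁ v₂ v₃

  p-coord : ∀ k {i} v → i ≢ k → coord i (p k v) ≡ coord i v
  p-coord zero {zero} v i≢k = ⊥-elim (i≢k ≡.refl)
  p-coord zero {suc zero} v _ = ≡.refl
  p-coord zero {suc (suc zero)} v _ = ≡.refl
  p-coord (suc zero) {zero} v _ = ≡.refl
  p-coord (suc zero) {suc zero} v i≢k = ⊥-elim (i≢k ≡.refl)
  p-coord (suc zero) {suc (suc zero)} v _ = ≡.refl
  p-coord (suc (suc zero)) {zero} v _ = ≡.refl
  p-coord (suc (suc zero)) {suc zero} v _ = ≡.refl
  p-coord (suc (suc zero)) {suc (suc zero)} v i≢k = ⊥-elim (i≢k ≡.refl)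

  coord-pt-∀ : ∀ (P : Carrier → Set ℓ) {l₁ l₂ l₃} → P l₁ → P l₂ → P l₃ → ∀ i → P (coord i (pt l₁ l₂ l₃))
  coord-pt-∀ _ P₁ _ _ zero = P₁
  coord-pt-∀ _ _ P₂ _ (suc zero) = P₂
  coord-pt-∀ _ _ _ P₃ (suc (suc zero)) = P₃

  affine-coord : ∀ {l₁ l₂ l₃ v q} → ((l₁ + l₂) + l₃) ≈ 1# → q ≈ᴾ comb l₁ l₂ l₃ v →
    ∀ i → coord i q + coord i (pt l₁ l₂ l₃) * Σᴾ v ≈ coord i v
  affine-coord {l₁} {l₂} {l₃} {v} Σl≈1 q≈comb i =
    trans (+-congʳ (≈ᴾ⇒coord-≈ q≈comb i))
      (trans (comb-coord l₁ l₂ l₃ v i) (trans (*-congʳ Σl≈1) (*-identityˡ (coord i v))))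

  inTriangle⇒≤ᴾ : ∀ {v q} → InH v → InTriangle v q → q ≤ᴾ v
  inTriangle⇒≤ᴾ 0<Σv (_ , _ , _ , Σl≈1 , 0≤l₁ , 0≤l₂ , 0≤l₃ , q≈comb) i =
    +-nonneg⇒≤ (affine-coord Σl≈1 q≈comb i) (*-nonneg-pos (coord-pt-∀ (0# ≤_) 0≤l₁ 0≤l₂ 0≤l₃ i) 0<Σv)

  inA⇒<ᴾ : ∀ {v q} → InH v → InA v q → q <ᴾ v
  inA⇒<ᴾ 0<Σv (_ , _ , _ , Σl≈1 , 0<l₁ , 0<l₂ , 0<l₃ , q≈comb) i =
    +-pos⇒< (affine-coord Σl≈1 q≈comb i) (*-pos (coord-pt-∀ (0# <_) 0<l₁ 0<l₂ 0<l₃ i) 0<Σv)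

  inA⇒Σᴾ≈0 : ∀ {v q} → InA v q → Σᴾ q ≈ 0#
  inA⇒Σᴾ≈0 {v} (l₁ , l₂ , l₃ , _ , _ , _ , _ , q≈comb) = trans (Σᴾ-cong q≈comb) (Σᴾ-comb l₁ l₂ l₃ v)

  ≤ᴾ⇒inTriangle : ∀ {v q} → InH v → Σᴾ q ≈ 0# → q ≤ᴾ v → InTriangle v q
  ≤ᴾ⇒inTriangle {v} {q} 0<Σv Σq≈0 q≤v =
    l zero , l (suc zero) , l (suc (suc zero)) , Σl≈1 , 0≤l zero , 0≤l (suc zero) , 0≤l (suc (suc zero)) ,
    coord-≈⇒≈ᴾ (λ i → sym (w≈q i))
    where
    Σv⁻¹ : ∃[ t ] (Σᴾ v * t ≈ 1#)
    Σv⁻¹ = inverse (Σᴾ v) (λ Σv≈0 → irrefl (sym Σv≈0) 0<Σv)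

    t : Carrier
    t = proj₁ Σv⁻¹

    Σv*t≈1 : Σᴾ v * t ≈ 1#
    Σv*t≈1 = proj₂ Σv⁻¹

    l : Fin 3 → Carrier
    l i = (coord i v - coord i q) * t

    0≤l : ∀ i → 0# ≤ l i
    0≤l i = *-nonneg-pos (≤⇒0≤- (q≤v i)) (inverse-pos 0<Σv Σv*t≈1)

    Σl≈1 : ((l zero + l (suc zero)) + l (suc (suc zero))) ≈ 1#
    Σl≈1 = begin
      (l zero + l (suc zero)) + l (suc (suc zero))  ≈⟨ Σ-distrib (x₁ v) (x₂ v) (x₃ v) (x₁ q) (x₂ q) (x₃ q) t ⟩
      Σᴾ v * t - Σᴾ q * t                           ≈⟨ +-cong Σv*t≈1 (-‿cong (*-congʳ Σq≈0)) ⟩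
      1# - 0# * t                                   ≈⟨ solve 2 (λ o t → o :- con (+ 0) :* t := o) refl 1# t ⟩
      1#                                            ∎
      where
      Σ-distrib : ∀ v₁ v₂ v₃ q₁ q₂ q₃ t →
        ((v₁ - q₁) * t + (v₂ - q₂) * t) + (v₃ - q₃) * t ≈ ((v₁ + v₂) + v₃) * t - ((q₁ + q₂) + q₃) * t
      Σ-distrib = solve 7 (λ v₁ v₂ v₃ q₁ q₂ q₃ t →
        ((v₁ :- q₁) :* t :+ (v₂ :- q₂) :* t) :+ (v₃ :- q₃) :* t
        := ((v₁ :+ v₂) :+ v₃) :* t :- ((q₁ :+ q₂) :+ q₃) :* t) refl

    l*Σv≈v-q : ∀ i → l i * Σᴾ v ≈ coord i v - coord i q
    l*Σv≈v-q i = begin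
      (coord i v - coord i q) * t * Σᴾ v    ≈⟨ *-assoc _ t (Σᴾ v) ⟩
      (coord i v - coord i q) * (t * Σᴾ v)  ≈⟨ *-congˡ (trans (*-comm t (Σᴾ v)) Σv*t≈1) ⟩
      (coord i v - coord i q) * 1#          ≈⟨ *-identityʳ _ ⟩
      coord i v - coord i q                 ∎

    w : Pt
    w = comb (l zero) (l (suc zero)) (l (suc (suc zero))) v

    w≈q : ∀ i → coord i w ≈ coord i q
    w≈q i = x+[y-z]≈y⇒x≈z (begin
      coord i w + (coord i v - coord i q)    ≈⟨ +-congˡ (l*Σv≈v-q i) ⟨
      coord i w + l i * Σᴾ v                 ≡⟨ cong (λ a → coord i w + a * Σᴾ v) (coord-tabulateᴾ l i) ⟨
      coord i w + coord i (tabulateᴾ l) * Σᴾ v  ≈⟨ affine-coord Σl≈1 (coord-≈⇒≈ᴾ (λ _ → refl)) i ⟩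
      coord i v                              ∎)
      where
      x+[y-z]≈y⇒x≈z : ∀ {x y z} → x + (y - z) ≈ y → x ≈ z
      x+[y-z]≈y⇒x≈z {x} {y} {z} e = begin
        x                        ≈⟨ solve 3 (λ x y z → x := ((x :+ (y :- z)) :- y) :+ z) refl x y z ⟩
        ((x + (y - z)) - y) + z  ≈⟨ +-congʳ (+-congʳ e) ⟩
        (y - y) + z              ≈⟨ solve 2 (λ y z → (y :- y) :+ z := z) refl y z ⟩
        z                        ∎

  coord-<-of-Σᴾ≈ : ∀ k {a b} → Σᴾ a ≈ Σᴾ b → (∀ j → j ≢ k → coord j b < coord j a) → coord k a < coord k b
  coord-<-of-Σᴾ≈ zero {pt a₁ a₂ a₃} {pt b₁ b₂ b₃} Σa≈Σb b<a = <-of-≈-sums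
    (trans (sym (+-assoc b₁ b₂ b₃)) (trans (sym Σa≈Σb) (+-assoc a₁ a₂ a₃)))
    (+-mono-<-< (b<a (suc zero) (λ ())) (b<a (suc (suc zero)) (λ ())))
  coord-<-of-Σᴾ≈ (suc zero) {pt a₁ a₂ a₃} {pt b₁ b₂ b₃} Σa≈Σb b<a = <-of-≈-sums
    (trans (sym (xy∙z≈y∙xz b₁ b₂ b₃)) (trans (sym Σa≈Σb) (xy∙z≈y∙xz a₁ a₂ a₃)))
    (+-mono-<-< (b<a zero (λ ())) (b<a (suc (suc zero)) (λ ())))
  coord-<-of-Σᴾ≈ (suc (suc zero)) {pt a₁ a₂ a₃} {pt b₁ b₂ b₃} Σa≈Σb b<a = <-of-≈-sums
    (trans (+-comm b₃ (b₁ + b₂)) (trans (sym Σa≈Σb) (+-comm (a₁ + a₂) a₃)))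
    (+-mono-<-< (b<a zero (λ ())) (b<a (suc zero) (λ ())))

  vertex-below : ∀ k {q x y z} → q <ᴾ x → q <ᴾ z → Σᴾ q ≈ 0# →
    p k y ≤ᴾ x → p k z ≤ᴾ y → p k z ≤ᴾ x
  vertex-below k {q} {x} {y} {z} q<x q<z Σq≈0 pky≤x pkz≤y i with i ≟ k
  ... | yes ≡.refl = inj₁ (<-trans (coord-<-of-Σᴾ≈ k (trans (Σᴾ-p k z) (sym Σq≈0)) q<pkz) (q<x k))
    where
    q<pkz : ∀ j → j ≢ k → coord j q < coord j (p k z)
    q<pkz j j≢k = subst (λ a → coord j q < a) (≡.sym (p-coord k z j≢k)) (q<z j)
  ... | no i≢k = ≤-trans (pkz≤y i) (subst (λ a → a ≤ coord i x) (p-coord k y i≢k) (pky≤x i))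

mainTheorem6 : {c ℓ : Level} (F : OrderedField c ℓ) → let open Geometry F in
    (x y z : Pt) (k : Fin 3) → InH x → InH y → InH z →
    Arrow k x y → Arrow k y z → Crossing x z → Arrow k x z
mainTheorem6 F x y z k 0<Σx 0<Σy 0<Σz (_ , pky∈△x) (_ , pkz∈△y) x⋈z@((q , q∈Ax , q∈Az) , _) =
  x⋈z , ≤ᴾ⇒inTriangle 0<Σx (Σᴾ-p k z)
          (vertex-below k (inA⇒<ᴾ 0<Σx q∈Ax) (inA⇒<ᴾ 0<Σz q∈Az) (inA⇒Σᴾ≈0 q∈Ax)
             (inTriangle⇒≤ᴾ 0<Σx pky∈△x) (inTriangle⇒≤ᴾ 0<Σy pkz∈△y))
  where open TriangleProperties F
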